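{- The set $\mathbb{Y}_\infty:=\bigcup_{n\ge0}\mathbb{Y}_n$ of groves is an involutive graded monoid for $+$: the sum is associative, has neutral element $|$, sends $\mathbb{Y}_n\times\mathbb{Y}_m$ to $\mathbb{Y}_{n+m}$, and the mirror involution $\sigma$ satisfies $\sigma(x+y)=\sigma(y)+\sigma(x)$. Moreover the maps $\mathbb{N}\to\mathbb{Y}_\infty$, $n\mapsto\underline{n}:=Y_n$, and $\mathbb{Y}_\infty\to\mathbb{N}$, $y\mapsto\deg y$, are morphisms of monoids (with $\mathbb{N}$ under addition).
   Context: A planar binary tree of degree $n\ge 0$ is a planar rooted tree (up to planar isotopy) with $n+1$ leaves in which every internal vertex has exactly two inputs; $Y_n$ is the set of these trees, $Y_0=\{|\}$. For $x\in Y_p$, $y\in Y_q$ the grafting $x\vee y\in Y_{p+q+1}$ joins the roots of $x$ and $y$ to a new vertex with a new root; every $x\in Y_n$, $n\ge1$, decomposes uniquely as $x=x^l\vee x^r$. Each $Y_n$ carries the Tamari partial order: the smallest partial order such that $(a\vee b)\vee c\le a\vee(b\vee c)$ for all trees $a,b,c$, and $a\le b$ implies $a\vee c\le b\vee c$ and $c\vee a\le c\vee b$. For $x\in Y_p,y\in Y_q$, $x/y\in Y_{p+q}$ is obtained by identifying the root of $x$ with the leftmost leaf of $y$, and $x\backslash y\in Y_{p+q}$ by identifying the rightmost leaf of $x$ with the root of $y$. The sum of trees is $x+y:=\{z\in Y_{p+q}: x/y\le z\le x\backslash y\}$. A grove of degree $n$ is a nonempty subset of $Y_n$; $\mathbb{Y}_n$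 is the set of groves of degree $n$, and the degree of a grove in $\mathbb{Y}_n$ is $n$. For groves $A,B$, $A+B$ is the union of the sets $a+b$ ($a\in A$, $b\in B$). The involution $\sigma$ maps a tree to its mirror image with respect to the vertical axis through the root, and acts on groves elementwise. -}

module Defs where

open import Data.Nat using (ℕ; zero; suc; _+_)
open import Data.Product using (Σ; ∃; _×_; _,_)
open import Relation.Binary.PropositionalEquality using (_≡_)

-- Planar binary trees.  |  is 'leaf',  x ∨ y  is 'node x y'.
data Tree : Set where
  leaf : Tree
  node : Tree → Tree → Tree

-- degree = number of internal vertices (so n+1 leaves); Y_n = trees of degree n
deg : Tree → ℕ
deg leaf       = zero
deg (node l r) = suc (deg l + deg r)

data _≤T_ : Tree → Tree → Set where
  ≤T-refl  : ∀ {x} → x ≤T x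
  ≤T-trans : ∀ {x y z} → x ≤T y → y ≤T z → x ≤T z
  ≤T-rot   : ∀ {a b c} → node (node a b) c ≤T node a (node b c)
  ≤T-left  : ∀ {a b c} → a ≤T b → node a c ≤T node b c
  ≤T-right : ∀ {a b c} → a ≤T b → node c a ≤T node c b

-- x / y : root of x identified with the leftmost leaf of y
_/T_ : Tree → Tree → Tree
x /T leaf     = x
x /T node l r = node (x /T l) r

-- x \ y : rightmost leaf of x identified with the root of y
_⟍_ : Tree → Tree → Tree
leaf     ⟍ y = y
node l r ⟍ y = node l (r ⟍ y)

mirror : Tree → Tree
mirror leaf       = leaf
mirror (node l r) = node (mirror r) (mirror l)

TSet : Set₁
TSet = Tree → Set

IsGrove : ℕ → TSet → Set
IsGrove n A = (∀ t → A t → deg t ≡ n) × ∃ A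

treeSum : Tree → Tree → TSet
treeSum x y z = (x /T y) ≤T z × z ≤T (x ⟍ y)

_⊕_ : TSet → TSet → TSet
(A ⊕ B) z = Σ Tree λ a → Σ Tree λ b → A a × B b × treeSum a b z

σ : TSet → TSet
σ A t = Σ Tree λ a → A a × mirror a ≡ t

unitG : TSet
unitG t = t ≡ leaf

full : ℕ → TSet
full n t = deg t ≡ n

_≐_ : TSet → TSet → Set
A ≐ B = (∀ t → A t → B t) × (∀ t → B t → A t)
infix 4 _≐_

-- The Tamari order is antisymmetric because the potential (the sum, over all vertices, of
-- the degree of the right subtree) strictly increases under a rotation.  Cutting a tree z
-- at its leaf p splits it into take p z and drop p z, and both cuts are monotone.  As x / y
-- and x \ y both cut at deg x into (x, y), antisymmetry shows that z ∈ x + y exactly when z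
-- cuts at deg x into (x, y).  Associativity then reduces to take/drop identities as for
-- lists, and the mirror, being antitone, exchanges / with \ and reverses sums.
module Submission where

open import Defs
open import Data.Nat using (ℕ; zero; suc; _+_; _≤_; _<_; z≤n; s≤s)
open import Data.Nat.Properties
open import Data.Nat.Tactic.RingSolver using (solve-∀)
open import Data.Product using (_×_; _,_; proj₁; proj₂)
open import Data.Sum using (_⊎_; inj₁; inj₂)
open import Data.Empty using (⊥-elim)
open import Relation.Binary.PropositionalEquality

+-suc-assoc : ∀ a b c → a + suc (b + c) ≡ suc (a + b + c)
+-suc-assoc = solve-∀

≤T-reflexive : ∀ {x y} → x ≡ y → x ≤T y
≤T-reflexive refl = ≤T-refl

≤T⇒deg≡ : ∀ {x y} → x ≤T y → deg x ≡ deg y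
≤T⇒deg≡ ≤T-refl              = refl
≤T⇒deg≡ (≤T-trans x≤y y≤z)   = trans (≤T⇒deg≡ x≤y) (≤T⇒deg≡ y≤z)
≤T⇒deg≡ (≤T-rot {a} {b} {c}) = cong suc (sym (+-suc-assoc (deg a) (deg b) (deg c)))
≤T⇒deg≡ (≤T-left {c = c} a≤b)  = cong (λ n → suc (n + deg c)) (≤T⇒deg≡ a≤b)
≤T⇒deg≡ (≤T-right {c = c} a≤b) = cong (λ n → suc (deg c + n)) (≤T⇒deg≡ a≤b)

potential : Tree → ℕ
potential leaf       = 0
potential (node l r) = potential l + potential r + deg r

≤T⇒≡⊎potential< : ∀ {x y} → x ≤T y → x ≡ y ⊎ potential x < potential y
≤T⇒≡⊎potential< ≤T-refl = inj₁ refl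
≤T⇒≡⊎potential< (≤T-trans x≤y y≤z) with ≤T⇒≡⊎potential< x≤y | ≤T⇒≡⊎potential< y≤z
... | inj₁ refl | y≡z⊎y<z  = y≡z⊎y<z
... | inj₂ x<y  | inj₁ refl = inj₂ x<y
... | inj₂ x<y  | inj₂ y<z  = inj₂ (<-trans x<y y<z)
≤T⇒≡⊎potential< (≤T-rot {a} {b} {c}) =
  inj₂ (subst (potential (node (node a b) c) <_)
              (sym (rot (potential a) (potential b) (potential c) (deg b) (deg c)))
              (m≤m+n _ (deg c)))
  where
  rot : ∀ pa pb pc db dc →
        pa + (pb + pc + dc) + suc (db + dc) ≡ suc (pa + pb + db + pc + dc) + dc
  rot = solve-∀
≤T⇒≡⊎potential< (≤T-left {c = c} a≤b) with ≤T⇒≡⊎potential< a≤b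
... | inj₁ refl = inj₁ refl
... | inj₂ a<b  = inj₂ (+-monoˡ-< (deg c) (+-monoˡ-< (potential c) a<b))
≤T⇒≡⊎potential< (≤T-right {a} {c = c} a≤b) with ≤T⇒≡⊎potential< a≤b
... | inj₁ refl = inj₁ refl
... | inj₂ a<b  = inj₂ (subst (λ n → potential c + potential a + deg a < potential c + _ + n)
                              (≤T⇒deg≡ a≤b)
                              (+-monoˡ-< (deg a) (+-monoʳ-< (potential c) a<b)))

≤T-antisym : ∀ {x y} → x ≤T y → y ≤T x → x ≡ y
≤T-antisym x≤y y≤x with ≤T⇒≡⊎potential< x≤y | ≤T⇒≡⊎potential< y≤x
... | inj₁ x≡y | _        = x≡y
... | inj₂ _   | inj₁ y≡x = sym y≡x
... | inj₂ x<y | inj₂ y<x = ⊥-elim (<-asym x<y y<x)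

deg-/T : ∀ x y → deg (x /T y) ≡ deg x + deg y
deg-/T x leaf       = sym (+-identityʳ (deg x))
deg-/T x (node l r) =
  trans (cong (λ n → suc (n + deg r)) (deg-/T x l)) (sym (+-suc-assoc (deg x) (deg l) (deg r)))

/T-identityˡ : ∀ x → leaf /T x ≡ x
/T-identityˡ leaf       = refl
/T-identityˡ (node l r) = cong (λ t → node t r) (/T-identityˡ l)

⟍-identityʳ : ∀ x → x ⟍ leaf ≡ x
⟍-identityʳ leaf       = refl
⟍-identityʳ (node l r) = cong (node l) (⟍-identityʳ r)

node-/T-≤T : ∀ l x y → (node l x /T y) ≤T node l (x /T y)
node-/T-≤T l x leaf       = ≤T-refl
node-/T-≤T l x (node c d) = ≤T-trans (≤T-left (node-/T-≤T l x c)) ≤T-rot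

node-⟍-≤T : ∀ x l r → node (x ⟍ l) r ≤T (x ⟍ node l r)
node-⟍-≤T leaf       l r = ≤T-refl
node-⟍-≤T (node c d) l r = ≤T-trans ≤T-rot (≤T-right (node-⟍-≤T d l r))

/T≤T⟍ : ∀ x y → (x /T y) ≤T (x ⟍ y)
/T≤T⟍ x leaf       = ≤T-reflexive (sym (⟍-identityʳ x))
/T≤T⟍ x (node l r) = ≤T-trans (≤T-left (/T≤T⟍ x l)) (node-⟍-≤T x l r)

data Position (p k : ℕ) : Set where
  within : p ≤ k → Position p k
  beyond : ∀ j → p ≡ suc (k + j) → Position p k

position : ∀ p k → Position p k
position zero    k       = within z≤n
position (suc p) zero    = beyond p refl
position (suc p) (suc k) with position p k
... | within p≤k   = within (s≤s p≤k)
... | beyond j p≡k = beyond j (cong suc p≡k)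

-- take p z and drop p z are the subtrees of z spanned by its leaves 0, …, p and
-- by its leaves p, …, deg z respectively (leaves numbered from the left from 0).
take : ℕ → Tree → Tree
take p leaf = leaf
take p (node l r) with position p (deg l)
... | within _   = take p l
... | beyond j _ = node l (take j r)

drop : ℕ → Tree → Tree
drop p leaf = leaf
drop p (node l r) with position p (deg l)
... | within _   = node (drop p l) r
... | beyond j _ = drop j r

take-within : ∀ {p} l r → p ≤ deg l → take p (node l r) ≡ take p l
take-within {p} l r p≤l with position p (deg l)
... | within _      = refl
... | beyond j refl = ⊥-elim (m+n≮m (deg l) j p≤l)

take-beyond : ∀ {p} l r j → p ≡ suc (deg l + j) → take p (node l r) ≡ node l (take j r)
take-beyond l r j refl with position (suc (deg l + j)) (deg l)
... | within p≤l = ⊥-elim (m+n≮m (deg l) j p≤l)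
... | beyond i e = cong (λ i → node l (take i r)) (sym (+-cancelˡ-≡ (deg l) _ _ (suc-injective e)))

drop-within : ∀ {p} l r → p ≤ deg l → drop p (node l r) ≡ node (drop p l) r
drop-within {p} l r p≤l with position p (deg l)
... | within _      = refl
... | beyond j refl = ⊥-elim (m+n≮m (deg l) j p≤l)

drop-beyond : ∀ {p} l r j → p ≡ suc (deg l + j) → drop p (node l r) ≡ drop j r
drop-beyond l r j refl with position (suc (deg l + j)) (deg l)
... | within p≤l = ⊥-elim (m+n≮m (deg l) j p≤l)
... | beyond i e = cong (λ i → drop i r) (sym (+-cancelˡ-≡ (deg l) _ _ (suc-injective e)))

take-mono : ∀ p {x y} → x ≤T y → take p x ≤T take p y
take-mono p ≤T-refl = ≤T-refl
take-mono p (≤T-trans x≤y y≤z) = ≤T-trans (take-mono p x≤y) (take-mono p y≤z)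
take-mono p (≤T-rot {a} {b} {c}) with position p (deg a)
... | within p≤a = ≤T-reflexive
  (trans (take-within (node a b) c (≤-trans p≤a (m≤n⇒m≤1+n (m≤m+n (deg a) (deg b)))))
         (take-within a b p≤a))
... | beyond j refl with position j (deg b)
...   | within j≤b = ≤T-reflexive
  (trans (take-within (node a b) c (s≤s (+-monoʳ-≤ (deg a) j≤b))) (take-beyond a b j refl))
...   | beyond i refl = ≤T-trans
  (≤T-reflexive (take-beyond (node a b) c i (cong suc (+-suc-assoc (deg a) (deg b) i))))
  ≤T-rot
take-mono p (≤T-left {a} {b} {c} a≤b) with position p (deg a)
... | within p≤a = ≤T-trans (take-mono p a≤b)
  (≤T-reflexive (sym (take-within b c (subst (p ≤_) (≤T⇒deg≡ a≤b) p≤a))))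
... | beyond j refl = ≤T-trans (≤T-left a≤b)
  (≤T-reflexive (sym (take-beyond b c j (cong (λ n → suc (n + j)) (≤T⇒deg≡ a≤b)))))
take-mono p (≤T-right {a} {b} {c} a≤b) with position p (deg c)
... | within p≤c    = ≤T-refl
... | beyond j refl = ≤T-right (take-mono j a≤b)

drop-mono : ∀ p {x y} → x ≤T y → drop p x ≤T drop p y
drop-mono p ≤T-refl = ≤T-refl
drop-mono p (≤T-trans x≤y y≤z) = ≤T-trans (drop-mono p x≤y) (drop-mono p y≤z)
drop-mono p (≤T-rot {a} {b} {c}) with position p (deg a)
... | within p≤a = ≤T-trans
  (≤T-reflexive (trans (drop-within (node a b) c (≤-trans p≤a (m≤n⇒m≤1+n (m≤m+n (deg a) (deg b)))))
                       (cong (λ t → node t c) (drop-within a b p≤a))))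
  ≤T-rot
... | beyond j refl with position j (deg b)
...   | within j≤b = ≤T-reflexive
  (trans (drop-within (node a b) c (s≤s (+-monoʳ-≤ (deg a) j≤b)))
         (cong (λ t → node t c) (drop-beyond a b j refl)))
...   | beyond i refl = ≤T-reflexive
  (drop-beyond (node a b) c i (cong suc (+-suc-assoc (deg a) (deg b) i)))
drop-mono p (≤T-left {a} {b} {c} a≤b) with position p (deg a)
... | within p≤a = ≤T-trans (≤T-left (drop-mono p a≤b))
  (≤T-reflexive (sym (drop-within b c (subst (p ≤_) (≤T⇒deg≡ a≤b) p≤a))))
... | beyond j refl = ≤T-reflexive
  (sym (drop-beyond b c j (cong (λ n → suc (n + j)) (≤T⇒deg≡ a≤b))))
drop-mono p (≤T-right {a} {b} {c} a≤b) with position p (deg c)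
... | within p≤c    = ≤T-right a≤b
... | beyond j refl = drop-mono j a≤b

take-deg : ∀ z → take (deg z) z ≡ z
take-deg leaf       = refl
take-deg (node l r) = trans (take-beyond l r (deg r) refl) (cong (node l) (take-deg r))

drop-deg : ∀ z → drop (deg z) z ≡ leaf
drop-deg leaf       = refl
drop-deg (node l r) = trans (drop-beyond l r (deg r) refl) (drop-deg r)

take-zero : ∀ z → take 0 z ≡ leaf
take-zero leaf       = refl
take-zero (node l r) = take-zero l

drop-zero : ∀ z → drop 0 z ≡ z
drop-zero leaf       = refl
drop-zero (node l r) = cong (λ t → node t r) (drop-zero l)

deg≤deg-/T : ∀ x y → deg x ≤ deg (x /T y)
deg≤deg-/T x y = subst (deg x ≤_) (sym (deg-/T x y)) (m≤m+n (deg x) (deg y))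

take-/T : ∀ x y → take (deg x) (x /T y) ≡ x
take-/T x leaf       = take-deg x
take-/T x (node l r) = trans (take-within (x /T l) r (deg≤deg-/T x l)) (take-/T x l)

drop-/T : ∀ x y → drop (deg x) (x /T y) ≡ y
drop-/T x leaf       = drop-deg x
drop-/T x (node l r) =
  trans (drop-within (x /T l) r (deg≤deg-/T x l)) (cong (λ t → node t r) (drop-/T x l))

take-⟍ : ∀ x y → take (deg x) (x ⟍ y) ≡ x
take-⟍ leaf       y = take-zero y
take-⟍ (node l r) y = trans (take-beyond l (r ⟍ y) (deg r) refl) (cong (node l) (take-⟍ r y))

drop-⟍ : ∀ x y → drop (deg x) (x ⟍ y) ≡ y
drop-⟍ leaf       y = drop-zero y
drop-⟍ (node l r) y = trans (drop-beyond l (r ⟍ y) (deg r) refl) (drop-⟍ r y)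

treeSum-deg : ∀ x y {z} → treeSum x y z → deg z ≡ deg x + deg y
treeSum-deg x y (x/y≤z , _) = trans (sym (≤T⇒deg≡ x/y≤z)) (deg-/T x y)

treeSum⇒take-drop : ∀ x y {z} → treeSum x y z → take (deg x) z ≡ x × drop (deg x) z ≡ y
treeSum⇒take-drop x y (x/y≤z , z≤x⟍y) =
  ≤T-antisym (≤T-trans (take-mono (deg x) z≤x⟍y) (≤T-reflexive (take-⟍ x y)))
             (≤T-trans (≤T-reflexive (sym (take-/T x y))) (take-mono (deg x) x/y≤z)) ,
  ≤T-antisym (≤T-trans (drop-mono (deg x) z≤x⟍y) (≤T-reflexive (drop-⟍ x y)))
             (≤T-trans (≤T-reflexive (sym (drop-/T x y))) (drop-mono (deg x) x/y≤z))

treeSum-take-drop : ∀ p z → treeSum (take p z) (drop p z) z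
treeSum-take-drop p leaf = ≤T-refl , ≤T-refl
treeSum-take-drop p (node l r) with position p (deg l)
... | within _ =
  ≤T-left (proj₁ (treeSum-take-drop p l)) ,
  ≤T-trans (≤T-left (proj₂ (treeSum-take-drop p l))) (node-⟍-≤T (take p l) (drop p l) r)
... | beyond j refl =
  ≤T-trans (node-/T-≤T l (take j r) (drop j r)) (≤T-right (proj₁ (treeSum-take-drop j r))) ,
  ≤T-right (proj₂ (treeSum-take-drop j r))

take-drop⇒treeSum : ∀ p {x y z} → take p z ≡ x → drop p z ≡ y → treeSum x y z
take-drop⇒treeSum p {z = z} refl refl = treeSum-take-drop p z

deg-take : ∀ p z → p ≤ deg z → deg (take p z) ≡ p
deg-take .zero leaf z≤n = refl
deg-take p (node l r) p≤z with position p (deg l)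
... | within p≤l    = deg-take p l p≤l
... | beyond j refl =
  cong (λ n → suc (deg l + n)) (deg-take j r (+-cancelˡ-≤ (deg l) _ _ (≤-pred p≤z)))

deg-drop : ∀ p z → p ≤ deg z → p + deg (drop p z) ≡ deg z
deg-drop p z p≤z = begin
  p + deg (drop p z)                ≡⟨ cong (_+ deg (drop p z)) (deg-take p z p≤z) ⟨
  deg (take p z) + deg (drop p z)   ≡⟨ treeSum-deg (take p z) (drop p z) (treeSum-take-drop p z) ⟨
  deg z                             ∎
  where open ≡-Reasoning

take-take : ∀ {p q} z → p ≤ q → take p (take q z) ≡ take p z
take-take leaf p≤q = refl
take-take {p} {q} (node l r) p≤q with position q (deg l)
... | within q≤l = trans (take-take l p≤q) (sym (take-within l r (≤-trans p≤q q≤l)))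
... | beyond j refl with position p (deg l)
...   | within _      = refl
...   | beyond i refl = cong (node l) (take-take r (+-cancelˡ-≤ (deg l) _ _ (≤-pred p≤q)))

+-≤-deg-drop : ∀ {p q} z → p ≤ deg z → q ≤ deg (drop p z) → p + q ≤ deg z
+-≤-deg-drop {p} {q} z p≤z q≤ = subst (p + q ≤_) (deg-drop p z p≤z) (+-monoʳ-≤ p q≤)

+-suc-deg-drop : ∀ {p} z i → p ≤ deg z → p + suc (deg (drop p z) + i) ≡ suc (deg z + i)
+-suc-deg-drop {p} z i p≤z = trans (+-suc-assoc p _ i) (cong (λ n → suc (n + i)) (deg-drop p z p≤z))

drop-drop : ∀ p q z → drop q (drop p z) ≡ drop (p + q) z
drop-drop p q leaf = refl
drop-drop p q (node l r) with position p (deg l)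
... | beyond j refl =
  trans (drop-drop j q r) (sym (drop-beyond l r (j + q) (cong suc (+-assoc (deg l) j q))))
... | within p≤l with position q (deg (drop p l))
...   | within q≤ =
  trans (cong (λ t → node t r) (drop-drop p q l)) (sym (drop-within l r (+-≤-deg-drop l p≤l q≤)))
...   | beyond i refl = sym (drop-beyond l r i (+-suc-deg-drop l i p≤l))

take-drop : ∀ p q z → take q (drop p z) ≡ drop p (take (p + q) z)
take-drop p q leaf = refl
take-drop p q (node l r) with position p (deg l)
... | beyond j refl = begin
  take q (drop j r)                                 ≡⟨ take-drop j q r ⟩
  drop j (take (j + q) r)                           ≡⟨ drop-beyond l (take (j + q) r) j refl ⟨
  drop (suc (deg l + j)) (node l (take (j + q) r))  ≡⟨ cong (drop (suc (deg l + j))) take-node ⟨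
  drop (suc (deg l + j)) (take (suc (deg l + j) + q) (node l r)) ∎
  where
  open ≡-Reasoning
  take-node : take (suc (deg l + j) + q) (node l r) ≡ node l (take (j + q) r)
  take-node = take-beyond l r (j + q) (cong suc (+-assoc (deg l) j q))
... | within p≤l with position q (deg (drop p l))
...   | within q≤ =
  trans (take-drop p q l) (cong (drop p) (sym (take-within l r (+-≤-deg-drop l p≤l q≤))))
...   | beyond i refl = sym (trans (cong (drop p) (take-beyond l r i (+-suc-deg-drop l i p≤l)))
                                   (drop-within l (take i r) p≤l))

mirror-involutive : ∀ t → mirror (mirror t) ≡ t
mirror-involutive leaf       = refl
mirror-involutive (node l r) = cong₂ node (mirror-involutive l) (mirror-involutive r)

deg-mirror : ∀ t → deg (mirror t) ≡ deg t
deg-mirror leaf       = refl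
deg-mirror (node l r) =
  cong suc (trans (cong₂ _+_ (deg-mirror r) (deg-mirror l)) (+-comm (deg r) (deg l)))

mirror-/T : ∀ x y → mirror (x /T y) ≡ (mirror y ⟍ mirror x)
mirror-/T x leaf       = refl
mirror-/T x (node l r) = cong (node (mirror r)) (mirror-/T x l)

mirror-⟍ : ∀ x y → mirror (x ⟍ y) ≡ (mirror y /T mirror x)
mirror-⟍ leaf       y = refl
mirror-⟍ (node l r) y = cong (λ t → node t (mirror l)) (mirror-⟍ r y)

mirror-antitone : ∀ {x y} → x ≤T y → mirror y ≤T mirror x
mirror-antitone ≤T-refl            = ≤T-refl
mirror-antitone (≤T-trans x≤y y≤z) = ≤T-trans (mirror-antitone y≤z) (mirror-antitone x≤y)
mirror-antitone ≤T-rot             = ≤T-rot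
mirror-antitone (≤T-left a≤b)      = ≤T-right (mirror-antitone a≤b)
mirror-antitone (≤T-right a≤b)     = ≤T-left (mirror-antitone a≤b)

treeSum-mirror : ∀ x y {z} → treeSum x y z → treeSum (mirror y) (mirror x) (mirror z)
treeSum-mirror x y (x/y≤z , z≤x⟍y) =
  ≤T-trans (≤T-reflexive (sym (mirror-⟍ x y))) (mirror-antitone z≤x⟍y) ,
  ≤T-trans (mirror-antitone x/y≤z) (≤T-reflexive (mirror-/T x y))

treeSum-mirror⁻¹ : ∀ x y {z} → treeSum (mirror y) (mirror x) z → treeSum x y (mirror z)
treeSum-mirror⁻¹ x y my+mx∋z =
  subst₂ (λ x y → treeSum x y _) (mirror-involutive x) (mirror-involutive y)
         (treeSum-mirror (mirror y) (mirror x) my+mx∋z)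

treeSum-leafˡ : ∀ y {z} → treeSum leaf y z → z ≡ y
treeSum-leafˡ y (y≤z , z≤y) = ≤T-antisym z≤y (≤T-trans (≤T-reflexive (sym (/T-identityˡ y))) y≤z)

treeSum-leafʳ : ∀ x {z} → treeSum x leaf z → z ≡ x
treeSum-leafʳ x (x≤z , z≤x) = ≤T-antisym (≤T-trans z≤x (≤T-reflexive (⟍-identityʳ x))) x≤z

⊕-grove : ∀ {n m A B} → IsGrove n A → IsGrove m B → IsGrove (n + m) (A ⊕ B)
⊕-grove (degA , a , Aa) (degB , b , Bb) =
  (λ { z (a′ , b′ , Aa′ , Bb′ , a′+b′∋z) →
         trans (treeSum-deg a′ b′ a′+b′∋z) (cong₂ _+_ (degA a′ Aa′) (degB b′ Bb′)) }) ,
  (a /T b , a , b , Aa , Bb , ≤T-refl , /T≤T⟍ a b)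

⊕-assoc : ∀ A B C → (A ⊕ B) ⊕ C ≐ A ⊕ (B ⊕ C)
⊕-assoc A B C = regroupʳ , regroupˡ
  where
  open ≡-Reasoning

  regroupʳ : ∀ z → ((A ⊕ B) ⊕ C) z → (A ⊕ (B ⊕ C)) z
  regroupʳ z (u , c , (a , b , Aa , Bb , a+b∋u) , Cc , u+c∋z) =
    a , drop p z , Aa , (b , c , Bb , Cc , take-drop⇒treeSum q take-q drop-q) ,
    take-drop⇒treeSum p take-p refl
    where
    p = deg a
    q = deg b
    u-split : take (p + q) z ≡ u × drop (p + q) z ≡ c
    u-split = subst (λ n → take n z ≡ u × drop n z ≡ c)
                    (treeSum-deg a b a+b∋u) (treeSum⇒take-drop u c u+c∋z)
    a-split : take p u ≡ a × drop p u ≡ b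
    a-split = treeSum⇒take-drop a b a+b∋u
    take-p : take p z ≡ a
    take-p = begin
      take p z                ≡⟨ take-take z (m≤m+n p q) ⟨
      take p (take (p + q) z) ≡⟨ cong (take p) (proj₁ u-split) ⟩
      take p u                ≡⟨ proj₁ a-split ⟩
      a                       ∎
    take-q : take q (drop p z) ≡ b
    take-q = begin
      take q (drop p z)       ≡⟨ take-drop p q z ⟩
      drop p (take (p + q) z) ≡⟨ cong (drop p) (proj₁ u-split) ⟩
      drop p u                ≡⟨ proj₂ a-split ⟩
      b                       ∎
    drop-q : drop q (drop p z) ≡ c
    drop-q = trans (drop-drop p q z) (proj₂ u-split)

  regroupˡ : ∀ z → (A ⊕ (B ⊕ C)) z → ((A ⊕ B) ⊕ C) z
  regroupˡ z (a , v , Aa , (b , c , Bb , Cc , b+c∋v) , a+v∋z) =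
    take (p + q) z , c , (a , b , Aa , Bb , take-drop⇒treeSum p take-p drop-p) ,
    Cc , take-drop⇒treeSum (p + q) refl drop-p+q
    where
    p = deg a
    q = deg b
    a-split : take p z ≡ a × drop p z ≡ v
    a-split = treeSum⇒take-drop a v a+v∋z
    b-split : take q v ≡ b × drop q v ≡ c
    b-split = treeSum⇒take-drop b c b+c∋v
    take-p : take p (take (p + q) z) ≡ a
    take-p = trans (take-take z (m≤m+n p q)) (proj₁ a-split)
    drop-p : drop p (take (p + q) z) ≡ b
    drop-p = begin
      drop p (take (p + q) z) ≡⟨ take-drop p q z ⟨
      take q (drop p z)       ≡⟨ cong (take q) (proj₂ a-split) ⟩
      take q v                ≡⟨ proj₁ b-split ⟩
      b                       ∎
    drop-p+q : drop (p + q) z ≡ c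
    drop-p+q = begin
      drop (p + q) z          ≡⟨ drop-drop p q z ⟨
      drop q (drop p z)       ≡⟨ cong (drop q) (proj₂ a-split) ⟩
      drop q v                ≡⟨ proj₂ b-split ⟩
      c                       ∎

unitG-grove : IsGrove zero unitG
unitG-grove = (λ { t refl → refl }) , (leaf , refl)

⊕-identityˡ : ∀ A → unitG ⊕ A ≐ A
⊕-identityˡ A =
  (λ { z (.leaf , b , refl , Ab , leaf+b∋z) → subst A (sym (treeSum-leafˡ b leaf+b∋z)) Ab }) ,
  (λ z Az → leaf , z , refl , Az , ≤T-reflexive (/T-identityˡ z) , ≤T-refl)

⊕-identityʳ : ∀ A → A ⊕ unitG ≐ A
⊕-identityʳ A =
  (λ { z (a , .leaf , Aa , refl , a+leaf∋z) → subst A (sym (treeSum-leafʳ a a+leaf∋z)) Aa }) ,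
  (λ z Az → z , leaf , Az , refl , ≤T-refl , ≤T-reflexive (sym (⟍-identityʳ z)))

σ-grove : ∀ {n A} → IsGrove n A → IsGrove n (σ A)
σ-grove (degA , a , Aa) =
  (λ { t (a′ , Aa′ , refl) → trans (deg-mirror a′) (degA a′ Aa′) }) , (mirror a , a , Aa , refl)

σ-involutive : ∀ A → σ (σ A) ≐ A
σ-involutive A =
  (λ { t (_ , (a , Aa , refl) , refl) → subst A (sym (mirror-involutive a)) Aa }) ,
  (λ t At → mirror t , (t , At , refl) , mirror-involutive t)

σ-⊕ : ∀ A B → σ (A ⊕ B) ≐ σ B ⊕ σ A
σ-⊕ A B =
  (λ { t (z , (a , b , Aa , Bb , a+b∋z) , refl) →
         mirror b , mirror a , (b , Bb , refl) , (a , Aa , refl) , treeSum-mirror a b a+b∋z }) ,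
  (λ { t (_ , _ , (b , Bb , refl) , (a , Aa , refl) , mb+ma∋t) →
         mirror t , (a , b , Aa , Bb , treeSum-mirror⁻¹ a b mb+ma∋t) , mirror-involutive t })

comb : ℕ → Tree
comb zero    = leaf
comb (suc n) = node leaf (comb n)

deg-comb : ∀ n → deg (comb n) ≡ n
deg-comb zero    = refl
deg-comb (suc n) = cong suc (deg-comb n)

full-grove : ∀ n → IsGrove n (full n)
full-grove n = (λ t deg≡n → deg≡n) , (comb n , deg-comb n)

full-zero : full zero ≐ unitG
full-zero = (λ { leaf _ → refl ; (node l r) () }) , (λ { t refl → refl })

full-+ : ∀ n m → full (n + m) ≐ full n ⊕ full m
full-+ n m =
  (λ z deg≡n+m →
     let n≤z = subst (n ≤_) (sym deg≡n+m) (m≤m+n n m) in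
     take n z , drop n z , deg-take n z n≤z ,
     +-cancelˡ-≡ n _ _ (trans (deg-drop n z n≤z) deg≡n+m) ,
     treeSum-take-drop n z) ,
  (λ { z (a , b , deg≡n , deg≡m , a+b∋z) → trans (treeSum-deg a b a+b∋z) (cong₂ _+_ deg≡n deg≡m) })

corollary2p7 :
    -- + sends Y_n × Y_m to Y_(n+m)  (deg is additive)
    (∀ n m A B → IsGrove n A → IsGrove m B → IsGrove (n + m) (A ⊕ B))
    -- associativity
    × (∀ n m k A B C → IsGrove n A → IsGrove m B → IsGrove k C →
         (A ⊕ B) ⊕ C ≐ A ⊕ (B ⊕ C))
    -- neutral element |  (a grove of degree 0)
    × IsGrove zero unitG
    × (∀ n A → IsGrove n A → (unitG ⊕ A ≐ A) × (A ⊕ unitG ≐ A))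
    -- σ is an involution on groves, preserving degree, and anti-multiplicative
    × (∀ n A → IsGrove n A → IsGrove n (σ A) × (σ (σ A) ≐ A))
    × (∀ n m A B → IsGrove n A → IsGrove m B → σ (A ⊕ B) ≐ σ B ⊕ σ A)
    -- n ↦ Y_n is a monoid morphism ℕ → Y_∞
    × (∀ n → IsGrove n (full n))
    × (full zero ≐ unitG)
    × (∀ n m → full (n + m) ≐ full n ⊕ full m)
corollary2p7 =
  (λ _ _ _ _ → ⊕-grove) ,
  (λ _ _ _ A B C _ _ _ → ⊕-assoc A B C) ,
  unitG-grove ,
  (λ _ A _ → ⊕-identityˡ A , ⊕-identityʳ A) ,
  (λ _ A A-grove → σ-grove A-grove , σ-involutive A) ,
  (λ _ _ A B _ _ → σ-⊕ A B) ,
  full-grove ,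
  full-zero ,
  full-+
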